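{- Let $U\subseteq W$ be subspaces of an $n$-dimensional vector space $V$ over $\mathbb{F}_q$ with $\dim U=d$ and $\dim W=k$. Let $T_o$ be a linear operator on $U$ with ordered list of invariant factors $\mathcal{I}$, and let $T_s\in L(W/U,V/U)$ be a simple linear transformation with defect dimensions $\lambda\vdash n-d$. Then the number of $T\in L(W,V)$ whose operator part is $T_o$ and whose simple part is $T_s$ equals $q^{d(k-d)}$.
   Context: $\mathbb{F}_q$ is the finite field with $q$ elements; $L(A,B)$ is the space of linear maps $A\to B$. For $T\in L(Y,X)$ with $Y\subseteq X$: define $Y_0=X$, $Y_1=Y$, $Y_{i+1}=\{v\in Y_i:Tv\in Y_i\}$, $d_i=\dim Y_i$, $\ell=\min\{i\ge0:Y_i=Y_{i+1}\}$; $Y_\ell$ is the maximal $T$-invariant subspace (largest $U'\subseteq Y$ with $TU'\subseteq U'$) and the defect dimensions are $(d_0-d_1,\ldots,d_{\ell-1}-d_\ell)$. $T$ is simple if every $T$-invariant subspace is $\{0\}$ or $X$. The operator part of $T\in L(W,V)$ is the restriction of $T$ to its maximal invariant subspace $U'$ (so "operator part is $T_o$" means $U'=U$ and $T|_U=T_o$); the simple part of $T$ is $\hat T:W/U'\to V/U'$, $\hat T(v+U')=Tv+U'$. Invariant factors of an operator on $U$: monic $p_1\mid\cdots\mid p_r$ of degree $\ge1$ with $U\cong\bigoplus\mathbb{F}_q[x]/(p_i)$, $x$ acting as the operator. -}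

module Defs where

open import Level using (0ℓ)
open import Data.Nat using (ℕ; zero; suc; _∸_; _<_; _≤_)
open import Data.Fin using (Fin; toℕ)
open import Data.Vec using (Vec; []; _∷_; zipWith; map; replicate; lookup)
open import Data.List using (List; length)
open import Data.Nat.ListAction using (sum)
import Data.List as List
open import Data.List.Relation.Unary.All using (All)
open import Data.List.Relation.Unary.Linked using (Linked)
open import Data.Nat using (_≥_)
open import Data.Product using (Σ; ∃; _×_; _,_)
open import Data.Unit using (⊤)
open import Data.Sum using (_⊎_)
open import Relation.Nullary using (¬_)
open import Relation.Binary.PropositionalEquality using (_≡_)
open import Algebra.Structures using (IsCommutativeRing)
open import Function.Bundles using (_↔_)

record FiniteField (q : ℕ) : Set₁ where
  infixl 6 _+_
  infixl 7 _*_
  field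
    Carrier : Set
    _+_ _*_ : Carrier → Carrier → Carrier
    -_      : Carrier → Carrier
    0# 1#   : Carrier
    isCommutativeRing : IsCommutativeRing _≡_ _+_ _*_ -_ 0# 1#
    0≢1     : ¬ (0# ≡ 1#)
    inverse : ∀ x → ¬ (x ≡ 0#) → ∃ λ y → x * y ≡ 1#
    enum    : Fin q ↔ Carrier

module _ {q : ℕ} (F : FiniteField q) where
  open FiniteField F

  Vect : ℕ → Set
  Vect n = Vec Carrier n

  Pred : ℕ → Set₁
  Pred n = Vect n → Set

  zeroV : ∀ {n} → Vect n
  zeroV = replicate _ 0#

  _+ᵥ_ : ∀ {n} → Vect n → Vect n → Vect n
  _+ᵥ_ = zipWith _+_

  _·_ : ∀ {n} → Carrier → Vect n → Vect n
  a · v = map (a *_) v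

  _-ᵥ_ : ∀ {n} → Vect n → Vect n → Vect n
  u -ᵥ v = u +ᵥ map -_ v

  linComb : ∀ {n m} → Vec Carrier m → Vec (Vect n) m → Vect n
  linComb []       []       = zeroV
  linComb (c ∷ cs) (v ∷ vs) = (c · v) +ᵥ linComb cs vs

  IsSubspace : ∀ {n} → Pred n → Set
  IsSubspace P = P zeroV
    × (∀ u v → P u → P v → P (u +ᵥ v))
    × (∀ a v → P v → P (a · v))

  _⊆_ : ∀ {n} → Pred n → Pred n → Set
  P ⊆ Q = ∀ v → P v → Q v

  SameSet : ∀ {n} → Pred n → Pred n → Set
  SameSet P Q = P ⊆ Q × Q ⊆ P

  HasDim : ∀ {n} → Pred n → ℕ → Set
  HasDim {n} P m = Σ (Vec (Vect n) m) λ bs →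
      (∀ i → P (lookup bs i))
    × (∀ cs → linComb cs bs ≡ zeroV → cs ≡ replicate m 0#)
    × (∀ v → P v → ∃ λ cs → v ≡ linComb cs bs)

  LinearOn : ∀ {n} → Pred n → (Vect n → Vect n) → Set
  LinearOn Y T = ∀ a b u v → Y u → Y v →
    T ((a · u) +ᵥ (b · v)) ≡ (a · T u) +ᵥ (b · T v)

  IsOperatorOn : ∀ {n} → Pred n → (Vect n → Vect n) → Set
  IsOperatorOn U T = LinearOn U T × (∀ u → U u → U (T u))

  -- Linear maps W/U → V/U (quotients modelled as setoids: a map is given
  -- on representatives, linear modulo U and sending U into U, which is
  -- exactly what makes it a well-defined linear map on W/U).
  -- Subspaces of V/U correspond to subspaces of V containing U.

  LinearModOn : ∀ {n} → Pred n → Pred n → (Vect n → Vect n) → Set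
  LinearModOn U W T =
      (∀ a b u v → W u → W v →
          U (T ((a · u) +ᵥ (b · v)) -ᵥ ((a · T u) +ᵥ (b · T v))))
    × (∀ u → U u → U (T u))

  IsQuotSubspace : ∀ {n} → Pred n → Pred n → Set
  IsQuotSubspace U Z = IsSubspace Z × U ⊆ Z

  -- T ∈ L(W/U, V/U) is simple: every T-invariant subspace Z/U
  -- (Z/U ⊆ W/U, T(Z/U) ⊆ Z/U) is {0} (i.e. Z = U) or V/U (i.e. Z = V).
  IsSimpleMod : ∀ {n} → Pred n → Pred n → (Vect n → Vect n) → Set₁
  IsSimpleMod U W T = ∀ Z → IsQuotSubspace U Z → Z ⊆ W →
    (∀ z → Z z → Z (T z)) →
    SameSet Z U ⊎ (∀ v → Z v)

  -- the chain Y_0 = V/U, Y_1 = W/U, Y_{i+1} = {v ∈ Y_i : T v ∈ Y_i}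
  -- (lifted to subspaces of V containing U)
  Ys : ∀ {n} → Pred n → (Vect n → Vect n) → ℕ → Pred n
  Ys W T zero             = λ _ → ⊤
  Ys W T (suc zero)       = W
  Ys W T (suc (suc i)) v  = Ys W T (suc i) v × Ys W T (suc i) (T v)

  -- λs is the list of defect dimensions (d_0-d_1, …, d_{ℓ-1}-d_ℓ) of T;
  -- ℓ = length λs. Since all Y_i contain U, dim(Y_i/U) differences equal
  -- the differences of the dimensions of the lifts.
  DefectDims : ∀ {n} → Pred n → (Vect n → Vect n) → List ℕ → Set
  DefectDims W T λs = Σ (ℕ → ℕ) λ ds →
      (∀ i → HasDim (Ys W T i) (ds i))
    × SameSet (Ys W T (length λs)) (Ys W T (suc (length λs)))
    × (∀ i → i < length λs → ¬ SameSet (Ys W T i) (Ys W T (suc i)))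
    × (∀ (i : Fin (length λs)) →
         List.lookup λs i ≡ ds (toℕ i) ∸ ds (suc (toℕ i)))

  IsMaxInvariant : ∀ {n} → Pred n → (Vect n → Vect n) → Pred n → Set₁
  IsMaxInvariant W T U' = IsSubspace U' × U' ⊆ W × (∀ u → U' u → U' (T u))
    × (∀ Z → IsSubspace Z → Z ⊆ W → (∀ z → Z z → Z (T z)) → Z ⊆ U')

  OperatorPartIs : ∀ {n} → Pred n → (Vect n → Vect n) → Pred n → (Vect n → Vect n) → Set₁
  OperatorPartIs W T U To = IsMaxInvariant W T U × (∀ u → U u → T u ≡ To u)

  -- the simple part of T (W/U → V/U, v+U ↦ Tv+U; here U' = U) is T_s
  SimplePartIs : ∀ {n} → Pred n → (Vect n → Vect n) → Pred n → (Vect n → Vect n) → Set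
  SimplePartIs W T U Ts = ∀ w → W w → U (T w -ᵥ Ts w)

  -- maps agreeing on W are the same element of L(W,V)
  SameOn : ∀ {n} → Pred n → (Vect n → Vect n) → (Vect n → Vect n) → Set
  SameOn W T T' = ∀ w → W w → T w ≡ T' w

IsPartition : List ℕ → ℕ → Set
IsPartition λs m = All (1 ≤_) λs × Linked _≥_ λs × sum λs ≡ m

HasCount : {A : Set} → (A → A → Set) → (A → Set₁) → ℕ → Set₁
HasCount {A} _≈_ P N = Σ (Vec A N) λ xs →
    (∀ i → P (lookup xs i))
  × (∀ i j → lookup xs i ≈ lookup xs j → i ≡ j)
  × (∀ x → P x → ∃ λ i → x ≈ lookup xs i)

-- Extend a basis b₁ … b_d of U by c₁ … c_{k-d} to a basis of W. A T with operator part T_o and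
-- simple part T_s agrees with T_o on U and with T_s modulo U on W, so
-- T(c_j) = T_s(c_j) + Σᵢ D_{ji} bᵢ for a unique D ∈ F_q^{(k-d)×d}. Conversely every D defines
-- such a T: its simple part is T_s, and for a T-invariant Z ⊆ W the space Z + U is T_s-invariant
-- modulo U, hence by simplicity equals U (so Z ⊆ U) or V. The latter forces W = V; then the
-- chain Y_i has no defects, so λ ⊢ 0 = n - d and U = V. Hence there are q^{d(k-d)} such T.
module Submission where

open import Defs
open import Data.Nat using (ℕ; _*_; _∸_; _^_)
open import Data.List using (List)
open import Data.Product using (_×_)

open import Level using (0ℓ)
import Data.Nat as ℕ
open import Data.Nat using (zero; suc; _≤_; _<_)
import Data.Nat.Properties as ℕ
import Data.List as List
open import Data.Fin using (Fin)
import Data.Fin.Properties as Fin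
open import Data.Vec using (Vec; []; _∷_; _++_; map; zipWith; replicate; lookup; tabulate)
import Data.Vec.Properties as Vec
open import Data.Vec.Recursive using (Fin[m^n]↔Fin[m]^n; lift↔)
open import Data.Vec.Recursive.Properties using (↔Vec)
open import Data.Vec.Relation.Unary.All as All using (All; []; _∷_)
import Data.Vec.Relation.Unary.All.Properties as All
open import Data.Vec.Relation.Binary.Pointwise.Inductive as Pointwise using (Pointwise; []; _∷_)
open import Data.Product using (∃; _,_; proj₁; proj₂)
open import Data.Sum using (_⊎_; inj₁; inj₂)
open import Data.Empty using (⊥-elim)
open import Data.Unit using (tt)
open import Function using (_∘_)
open import Function.Bundles using (_↔_; Inverse; Injection)
open import Function.Properties.Inverse using (↔-sym; ↔-trans; ↔⇒↣)
open import Relation.Nullary using (¬_; Dec; yes; no; contradiction)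
import Relation.Nullary.Decidable as Dec
open import Relation.Binary.PropositionalEquality
open import Relation.Binary.Bundles using (Setoid)
open import Algebra.Bundles using (AbelianGroup; CommutativeRing)
open import Algebra.Structures using (IsCommutativeRing; IsAbelianGroup)

Fin[N^m]↔Vec : ∀ {N} {A : Set} → Fin N ↔ A → (m : ℕ) → Fin (N ^ m) ↔ Vec A m
Fin[N^m]↔Vec {N} e m = ↔-trans (Fin[m^n]↔Fin[m]^n N m) (↔-trans (lift↔ m e) (↔Vec m))

HasCount-↔ : ∀ {A I : Set} {_≈_ : A → A → Set} {P : A → Set₁} {N} →
  Fin N ↔ I → (f : I → A) →
  (∀ i → P (f i)) → (∀ i j → f i ≈ f j → i ≡ j) → (∀ x → P x → ∃ λ i → x ≈ f i) →
  HasCount _≈_ P N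
HasCount-↔ {A} {_≈_ = _≈_} {P} {N} e f good distinct complete =
  tabulate g , good′ , distinct′ , complete′
  where
  open Inverse e
  g : Fin N → A
  g = f ∘ to
  g≡ : ∀ n → lookup (tabulate g) n ≡ f (to n)
  g≡ = Vec.lookup∘tabulate g
  good′ : ∀ n → P (lookup (tabulate g) n)
  good′ n = subst P (sym (g≡ n)) (good (to n))
  distinct′ : ∀ m n → lookup (tabulate g) m ≈ lookup (tabulate g) n → m ≡ n
  distinct′ m n eq = Injection.injective (↔⇒↣ e) (distinct _ _ (subst₂ _≈_ (g≡ m) (g≡ n) eq))
  complete′ : ∀ x → P x → ∃ λ n → x ≈ lookup (tabulate g) n
  complete′ x px with complete x px
  ... | i , x≈fi = from i , subst (x ≈_) (sym (trans (g≡ (from i)) (cong f (strictlyInverseˡ i)))) x≈fi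

module _ {q : ℕ} (F : FiniteField q) where
  open FiniteField F renaming (_*_ to _*ᶠ_)

  private
    ring : CommutativeRing 0ℓ 0ℓ
    ring = record { isCommutativeRing = isCommutativeRing }
  open IsCommutativeRing isCommutativeRing using
    ( +-assoc; +-comm; +-identityˡ; +-identityʳ; -‿inverseˡ; -‿inverseʳ
    ; *-assoc; *-comm; *-identityˡ; distribˡ; distribʳ; zeroˡ; zeroʳ )
  open import Algebra.Properties.Ring (CommutativeRing.ring ring) using (-1*x≈-x; -‿distribʳ-*)

  infixl 6 _⊕_ _⊖_
  infixr 7 _⊙_

  _⊕_ _⊖_ : ∀ {m} → Vect F m → Vect F m → Vect F m
  _⊕_ = _+ᵥ_ F
  _⊖_ = _-ᵥ_ F

  _⊙_ : ∀ {m} → Carrier → Vect F m → Vect F m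
  _⊙_ = _·_ F

  𝟎 : ∀ {m} → Vect F m
  𝟎 = zeroV F

  ⊕-isAbelianGroup : ∀ m → IsAbelianGroup _≡_ (_⊕_ {m}) 𝟎 (map -_)
  ⊕-isAbelianGroup m = record
    { isGroup = record
      { isMonoid = record
        { isSemigroup = record
          { isMagma = record { isEquivalence = isEquivalence ; ∙-cong = cong₂ _⊕_ }
          ; assoc = Vec.zipWith-assoc +-assoc }
        ; identity = Vec.zipWith-identityˡ +-identityˡ , Vec.zipWith-identityʳ +-identityʳ }
      ; inverse = Vec.zipWith-inverseˡ -‿inverseˡ , Vec.zipWith-inverseʳ -‿inverseʳ
      ; ⁻¹-cong = cong (map -_) }
    ; comm = Vec.zipWith-comm +-comm }

  ⊕-abelianGroup : ℕ → AbelianGroup 0ℓ 0ℓ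
  ⊕-abelianGroup m = record { isAbelianGroup = ⊕-isAbelianGroup m }

  module VectorGroup {m : ℕ} where
    open AbelianGroup (⊕-abelianGroup m) public
      using (assoc; comm; identityˡ; identityʳ; inverseʳ; commutativeSemigroup)
    open import Algebra.Properties.AbelianGroup (⊕-abelianGroup m) public
    open import Algebra.Properties.CommutativeSemigroup commutativeSemigroup public
      using (interchange)
  open VectorGroup

  ⊙-distribˡ : ∀ {m} a (u v : Vect F m) → a ⊙ (u ⊕ v) ≡ a ⊙ u ⊕ a ⊙ v
  ⊙-distribˡ a []       []       = refl
  ⊙-distribˡ a (x ∷ u) (y ∷ v) = cong₂ _∷_ (distribˡ a x y) (⊙-distribˡ a u v)

  ⊙-distribʳ : ∀ {m} a b (u : Vect F m) → (a + b) ⊙ u ≡ a ⊙ u ⊕ b ⊙ u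
  ⊙-distribʳ a b []       = refl
  ⊙-distribʳ a b (x ∷ u) = cong₂ _∷_ (distribʳ x a b) (⊙-distribʳ a b u)

  ⊙-distrib-⊖ : ∀ {m} a (u v : Vect F m) → a ⊙ (u ⊖ v) ≡ a ⊙ u ⊖ a ⊙ v
  ⊙-distrib-⊖ a []       []       = refl
  ⊙-distrib-⊖ a (x ∷ u) (y ∷ v) = cong₂ _∷_
    (trans (distribˡ a x (- y)) (cong (a *ᶠ x +_) (sym (-‿distribʳ-* a y))))
    (⊙-distrib-⊖ a u v)

  ⊙-assoc : ∀ {m} a b (u : Vect F m) → a ⊙ b ⊙ u ≡ (a *ᶠ b) ⊙ u
  ⊙-assoc a b u = trans (sym (Vec.map-∘ _ _ u)) (Vec.map-cong (λ x → sym (*-assoc a b x)) u)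

  ⊙-identityˡ : ∀ {m} (u : Vect F m) → 1# ⊙ u ≡ u
  ⊙-identityˡ u = trans (Vec.map-cong *-identityˡ u) (Vec.map-id u)

  ⊙-zeroˡ : ∀ {m} (u : Vect F m) → 0# ⊙ u ≡ 𝟎
  ⊙-zeroˡ u = trans (Vec.map-cong zeroˡ u) (Vec.map-const u 0#)

  ⊙-zeroʳ : ∀ {m} a → a ⊙ 𝟎 {m} ≡ 𝟎
  ⊙-zeroʳ {m} a = trans (Vec.map-replicate (a *ᶠ_) 0# m) (cong (replicate m) (zeroʳ a))

  -‿≡-1⊙ : ∀ {m} (u : Vect F m) → map -_ u ≡ (- 1#) ⊙ u
  -‿≡-1⊙ u = Vec.map-cong (λ x → sym (-1*x≈-x x)) u

  lc : ∀ {n m} → Vec Carrier m → Vec (Vect F n) m → Vect F n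
  lc = linComb F

  linComb-zeros : ∀ {n m} (vs : Vec (Vect F n) m) → lc (replicate m 0#) vs ≡ 𝟎
  linComb-zeros []       = refl
  linComb-zeros (v ∷ vs) = trans (cong₂ _⊕_ (⊙-zeroˡ v) (linComb-zeros vs)) (identityˡ 𝟎)

  linComb-⊕ : ∀ {n m} (cs ds : Vec Carrier m) (vs : Vec (Vect F n) m) →
    lc (cs ⊕ ds) vs ≡ lc cs vs ⊕ lc ds vs
  linComb-⊕ []       []       []       = sym (identityˡ 𝟎)
  linComb-⊕ (c ∷ cs) (d ∷ ds) (v ∷ vs) =
    trans (cong₂ _⊕_ (⊙-distribʳ c d v) (linComb-⊕ cs ds vs))
          (interchange (c ⊙ v) (d ⊙ v) (lc cs vs) (lc ds vs))

  linComb-⊙ : ∀ {n m} a (cs : Vec Carrier m) (vs : Vec (Vect F n) m) →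
    lc (a ⊙ cs) vs ≡ a ⊙ lc cs vs
  linComb-⊙ a []       []       = sym (⊙-zeroʳ a)
  linComb-⊙ a (c ∷ cs) (v ∷ vs) =
    trans (cong₂ _⊕_ (sym (⊙-assoc a c v)) (linComb-⊙ a cs vs))
          (sym (⊙-distribˡ a (c ⊙ v) (lc cs vs)))

  linComb-linear : ∀ {n m} a b (cs ds : Vec Carrier m) (vs : Vec (Vect F n) m) →
    lc (a ⊙ cs ⊕ b ⊙ ds) vs ≡ a ⊙ lc cs vs ⊕ b ⊙ lc ds vs
  linComb-linear a b cs ds vs =
    trans (linComb-⊕ (a ⊙ cs) (b ⊙ ds) vs) (cong₂ _⊕_ (linComb-⊙ a cs vs) (linComb-⊙ b ds vs))

  linComb-⊖ : ∀ {n m} (cs ds : Vec Carrier m) (vs : Vec (Vect F n) m) →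
    lc (cs ⊖ ds) vs ≡ lc cs vs ⊖ lc ds vs
  linComb-⊖ cs ds vs = begin
    lc (cs ⊕ map -_ ds) vs          ≡⟨ linComb-⊕ cs (map -_ ds) vs ⟩
    lc cs vs ⊕ lc (map -_ ds) vs    ≡⟨ cong (λ es → lc cs vs ⊕ lc es vs) (-‿≡-1⊙ ds) ⟩
    lc cs vs ⊕ lc ((- 1#) ⊙ ds) vs  ≡⟨ cong (lc cs vs ⊕_) (linComb-⊙ (- 1#) ds vs) ⟩
    lc cs vs ⊕ (- 1#) ⊙ lc ds vs    ≡⟨ cong (lc cs vs ⊕_) (sym (-‿≡-1⊙ (lc ds vs))) ⟩
    lc cs vs ⊖ lc ds vs             ∎
    where open ≡-Reasoning

  linComb-++ : ∀ {n m j} (cs : Vec Carrier m) (ds : Vec Carrier j) vs (ws : Vec (Vect F n) j) →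
    lc (cs ++ ds) (vs ++ ws) ≡ lc cs vs ⊕ lc ds ws
  linComb-++ []       ds []       ws = sym (identityˡ _)
  linComb-++ (c ∷ cs) ds (v ∷ vs) ws =
    trans (cong (c ⊙ v ⊕_) (linComb-++ cs ds vs ws)) (sym (assoc (c ⊙ v) (lc cs vs) (lc ds ws)))

  linComb-1∷zeros : ∀ {n m} v (vs : Vec (Vect F n) m) → lc (1# ∷ replicate m 0#) (v ∷ vs) ≡ v
  linComb-1∷zeros v vs = trans (cong₂ _⊕_ (⊙-identityˡ v) (linComb-zeros vs)) (identityʳ v)

  linComb-0∷ : ∀ {n m} v (vs : Vec (Vect F n) m) cs → lc (0# ∷ cs) (v ∷ vs) ≡ lc cs vs
  linComb-0∷ v vs cs = trans (cong (_⊕ lc cs vs) (⊙-zeroˡ v)) (identityˡ _)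

  linComb-zeros-++ : ∀ {n m j} (cs : Vec Carrier m) (vs : Vec (Vect F n) j) ws →
    lc (replicate j 0# ++ cs) (vs ++ ws) ≡ lc cs ws
  linComb-zeros-++ cs vs ws = trans (linComb-++ (replicate _ 0#) cs vs ws)
    (trans (cong (_⊕ lc cs ws) (linComb-zeros vs)) (identityˡ _))

  linComb-extensional : ∀ {n m} (vs ws : Vec (Vect F n) m) →
    (∀ cs → lc cs vs ≡ lc cs ws) → vs ≡ ws
  linComb-extensional []       []       _  = refl
  linComb-extensional (v ∷ vs) (w ∷ ws) eq = cong₂ _∷_
    (trans (sym (linComb-1∷zeros v vs)) (trans (eq (1# ∷ replicate _ 0#)) (linComb-1∷zeros w ws)))
    (linComb-extensional vs ws λ cs →
      trans (sym (linComb-0∷ v vs cs)) (trans (eq (0# ∷ cs)) (linComb-0∷ w ws cs)))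

  module _ {n : ℕ} {P : Pred F n} (P-sub : IsSubspace F P) where
    private
      P-𝟎 : P 𝟎
      P-𝟎 = proj₁ P-sub
      P-⊕ : ∀ u v → P u → P v → P (u ⊕ v)
      P-⊕ = proj₁ (proj₂ P-sub)
      P-⊙ : ∀ a v → P v → P (a ⊙ v)
      P-⊙ = proj₂ (proj₂ P-sub)

    subspace-linComb : ∀ {m} {vs : Vec (Vect F n) m} → All P vs → ∀ cs → P (lc cs vs)
    subspace-linComb []         []       = P-𝟎
    subspace-linComb (pv ∷ pvs) (c ∷ cs) = P-⊕ _ _ (P-⊙ c _ pv) (subspace-linComb pvs cs)

    subspace-neg : ∀ {u} → P u → P (map -_ u)
    subspace-neg {u} pu = subst P (sym (-‿≡-1⊙ u)) (P-⊙ (- 1#) u pu)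

    subspace-⊖ : ∀ {u v} → P u → P v → P (u ⊖ v)
    subspace-⊖ pu pv = P-⊕ _ _ pu (subspace-neg pv)

  module _ {n : ℕ} {Y : Pred F n} (Y-sub : IsSubspace F Y) {T : Vect F n → Vect F n}
           (T-lin : LinearOn F Y T) where

    linear-𝟎 : T 𝟎 ≡ 𝟎
    linear-𝟎 = begin
      T 𝟎                    ≡⟨ cong T (sym (zero-combination 𝟎 𝟎)) ⟩
      T (0# ⊙ 𝟎 ⊕ 0# ⊙ 𝟎)    ≡⟨ T-lin 0# 0# 𝟎 𝟎 (proj₁ Y-sub) (proj₁ Y-sub) ⟩
      0# ⊙ T 𝟎 ⊕ 0# ⊙ T 𝟎    ≡⟨ zero-combination (T 𝟎) (T 𝟎) ⟩
      𝟎                      ∎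
      where
      open ≡-Reasoning
      zero-combination : ∀ u v → 0# ⊙ u ⊕ 0# ⊙ v ≡ 𝟎
      zero-combination u v = trans (cong₂ _⊕_ (⊙-zeroˡ u) (⊙-zeroˡ v)) (identityˡ 𝟎)

    linear-⊕ : ∀ {u v} → Y u → Y v → T (u ⊕ v) ≡ T u ⊕ T v
    linear-⊕ {u} {v} u∈Y v∈Y = begin
      T (u ⊕ v)               ≡⟨ cong T (sym (cong₂ _⊕_ (⊙-identityˡ u) (⊙-identityˡ v))) ⟩
      T (1# ⊙ u ⊕ 1# ⊙ v)     ≡⟨ T-lin 1# 1# u v u∈Y v∈Y ⟩
      1# ⊙ T u ⊕ 1# ⊙ T v     ≡⟨ cong₂ _⊕_ (⊙-identityˡ (T u)) (⊙-identityˡ (T v)) ⟩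
      T u ⊕ T v               ∎
      where open ≡-Reasoning

    linear-linComb : ∀ {m} {vs : Vec (Vect F n) m} → All Y vs → ∀ cs →
      T (lc cs vs) ≡ lc cs (map T vs)
    linear-linComb []                  []       = linear-𝟎
    linear-linComb {vs = v ∷ vs} (yv ∷ yvs) (c ∷ cs) = begin
      T (c ⊙ v ⊕ lc cs vs)              ≡⟨ cong (λ w → T (c ⊙ v ⊕ w)) (sym (⊙-identityˡ _)) ⟩
      T (c ⊙ v ⊕ 1# ⊙ lc cs vs)         ≡⟨ T-lin c 1# v _ yv (subspace-linComb Y-sub yvs cs) ⟩
      c ⊙ T v ⊕ 1# ⊙ T (lc cs vs)       ≡⟨ cong (c ⊙ T v ⊕_) (⊙-identityˡ _) ⟩
      c ⊙ T v ⊕ T (lc cs vs)            ≡⟨ cong (c ⊙ T v ⊕_) (linear-linComb yvs cs) ⟩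
      c ⊙ T v ⊕ lc cs (map T vs)        ∎
      where open ≡-Reasoning

  module Modulo {n : ℕ} {U : Pred F n} (U-sub : IsSubspace F U) where

    infix 4 _≈_
    _≈_ : Vect F n → Vect F n → Set
    u ≈ v = U (u ⊖ v)

    ≈-reflexive : ∀ {u v} → u ≡ v → u ≈ v
    ≈-reflexive {u} refl = subst U (sym (inverseʳ u)) (proj₁ U-sub)

    ≈-refl : ∀ {u} → u ≈ u
    ≈-refl = ≈-reflexive refl

    ≈-sym : ∀ {u v} → u ≈ v → v ≈ u
    ≈-sym {u} {v} u≈v = subst U (⁻¹-anti-homo‿- u v) (subspace-neg U-sub u≈v)

    ≈-trans : ∀ {u v w} → u ≈ v → v ≈ w → u ≈ w
    ≈-trans {u} {v} {w} u≈v v≈w = subst U telescope (proj₁ (proj₂ U-sub) _ _ u≈v v≈w)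
      where
      telescope : (u ⊖ v) ⊕ (v ⊖ w) ≡ u ⊖ w
      telescope = trans (assoc u (map -_ v) (v ⊖ w)) (cong (u ⊕_) (\\-leftDividesʳ v (map -_ w)))

    ≈-setoid : Setoid 0ℓ 0ℓ
    ≈-setoid = record
      { Carrier = Vect F n ; _≈_ = _≈_
      ; isEquivalence = record { refl = ≈-refl ; sym = ≈-sym ; trans = ≈-trans } }

    ⊕-cong : ∀ {u u′ v v′} → u ≈ u′ → v ≈ v′ → u ⊕ v ≈ u′ ⊕ v′
    ⊕-cong {u} {u′} {v} {v′} u≈u′ v≈v′ = subst U regroup (proj₁ (proj₂ U-sub) _ _ u≈u′ v≈v′)
      where
      regroup : (u ⊖ u′) ⊕ (v ⊖ v′) ≡ (u ⊕ v) ⊖ (u′ ⊕ v′)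
      regroup = trans (interchange u (map -_ u′) v (map -_ v′))
                      (cong ((u ⊕ v) ⊕_) (⁻¹-∙-comm u′ v′))

    ⊙-cong : ∀ a {u v} → u ≈ v → a ⊙ u ≈ a ⊙ v
    ⊙-cong a {u} {v} u≈v = subst U (⊙-distrib-⊖ a u v) (proj₂ (proj₂ U-sub) a _ u≈v)

    members-≈ : ∀ {u v} → U u → U v → u ≈ v
    members-≈ = subspace-⊖ U-sub

    ⊕-absorbʳ : ∀ {u} v → U u → v ⊕ u ≈ v
    ⊕-absorbʳ {u} v u∈U = ≈-trans (⊕-cong ≈-refl (members-≈ u∈U (proj₁ U-sub)))
                                  (≈-reflexive (identityʳ v))

    linComb-cong : ∀ {m} {vs ws : Vec (Vect F n) m} → Pointwise _≈_ vs ws → ∀ cs →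
      lc cs vs ≈ lc cs ws
    linComb-cong []            []       = ≈-refl
    linComb-cong (v≈w ∷ vs≈ws) (c ∷ cs) = ⊕-cong (⊙-cong c v≈w) (linComb-cong vs≈ws cs)

    linearMod-linComb : ∀ {W : Pred F n} {T} → IsSubspace F W → LinearModOn F U W T →
      ∀ {m} {vs : Vec (Vect F n) m} → All W vs → ∀ cs → T (lc cs vs) ≈ lc cs (map T vs)
    linearMod-linComb W-sub (_ , T-U) []         []       = members-≈ (T-U 𝟎 (proj₁ U-sub)) (proj₁ U-sub)
    linearMod-linComb {T = T} W-sub T-lin@(T-lin₂ , _) {vs = v ∷ vs} (v∈W ∷ vs⊆W) (c ∷ cs) = begin
      T (c ⊙ v ⊕ lc cs vs)              ≡⟨ cong (λ w → T (c ⊙ v ⊕ w)) (sym (⊙-identityˡ _)) ⟩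
      T (c ⊙ v ⊕ 1# ⊙ lc cs vs)         ≈⟨ T-lin₂ c 1# v _ v∈W (subspace-linComb W-sub vs⊆W cs) ⟩
      c ⊙ T v ⊕ 1# ⊙ T (lc cs vs)       ≡⟨ cong (c ⊙ T v ⊕_) (⊙-identityˡ _) ⟩
      c ⊙ T v ⊕ T (lc cs vs)            ≈⟨ ⊕-cong ≈-refl (linearMod-linComb W-sub T-lin vs⊆W cs) ⟩
      c ⊙ T v ⊕ lc cs (map T vs)        ∎
      where open import Relation.Binary.Reasoning.Setoid ≈-setoid

  _≟_ : (x y : Carrier) → Dec (x ≡ y)
  x ≟ y with Inverse.from enum x Fin.≟ Inverse.from enum y
  ... | yes eq = yes (Injection.injective (↔⇒↣ (↔-sym enum)) eq)
  ... | no neq = no (λ x≡y → neq (cong (Inverse.from enum) x≡y))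

  1<q : 1 < q
  1<q = two-elements enum
    where
    two-elements : ∀ {r} → Fin r ↔ Carrier → 1 < r
    two-elements {zero}        e = contradiction (Inverse.from e 0#) λ ()
    two-elements {suc zero}    e =
      contradiction (Injection.injective (↔⇒↣ (↔-sym e)) (Injection.injective (↔⇒↣ Fin.1↔⊤) refl)) 0≢1
    two-elements {suc (suc _)} _ = ℕ.s≤s (ℕ.s≤s ℕ.z≤n)

  Independent : ∀ {n m} → Vec (Vect F n) m → Set
  Independent {m = m} vs = ∀ cs → lc cs vs ≡ 𝟎 → cs ≡ replicate m 0#

  InSpan : ∀ {n m} → Vec (Vect F n) m → Vect F n → Set
  InSpan vs v = ∃ λ cs → v ≡ lc cs vs

  Fin[q^m]↔Vec : ∀ m → Fin (q ^ m) ↔ Vec Carrier m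
  Fin[q^m]↔Vec = Fin[N^m]↔Vec enum

  injective⇒≤ : ∀ {m j} (f : Vec Carrier m → Vec Carrier j) →
    (∀ {xs ys} → f xs ≡ f ys → xs ≡ ys) → m ≤ j
  injective⇒≤ {m} {j} f f-inj = ℕ.≮⇒≥ λ j<m →
    ℕ.<⇒≱ (ℕ.^-monoʳ-< q 1<q j<m) (Fin.injective⇒≤ {f = g} (g-inj _ _))
    where
    open Inverse
    g : Fin (q ^ m) → Fin (q ^ j)
    g i = from (Fin[q^m]↔Vec j) (f (to (Fin[q^m]↔Vec m) i))
    g-inj : ∀ i i′ → g i ≡ g i′ → i ≡ i′
    g-inj i i′ = Injection.injective (↔⇒↣ (Fin[q^m]↔Vec m))
               ∘ f-inj ∘ Injection.injective (↔⇒↣ (↔-sym (Fin[q^m]↔Vec j)))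

  inSpan? : ∀ {n m} (vs : Vec (Vect F n) m) v → Dec (InSpan vs v)
  inSpan? {m = m} vs v =
    Dec.map′ (λ (i , v≡) → to i , v≡) search-hits (Fin.any? λ i → Vec.≡-dec _≟_ v (lc (to i) vs))
    where
    open Inverse (Fin[q^m]↔Vec m)
    search-hits : InSpan vs v → ∃ λ i → v ≡ lc (to i) vs
    search-hits (cs , v≡) = from cs , subst (λ ds → v ≡ lc ds vs) (sym (strictlyInverseˡ cs)) v≡

  independent⇒linComb-injective : ∀ {n m} {vs : Vec (Vect F n) m} → Independent vs →
    ∀ {cs ds} → lc cs vs ≡ lc ds vs → cs ≡ ds
  independent⇒linComb-injective {vs = vs} vs-indep {cs} {ds} eq =
    x∙y⁻¹≈ε⇒x≈y cs ds (vs-indep (cs ⊖ ds) (begin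
      lc (cs ⊖ ds) vs        ≡⟨ linComb-⊖ cs ds vs ⟩
      lc cs vs ⊖ lc ds vs    ≡⟨ cong (_⊖ lc ds vs) eq ⟩
      lc ds vs ⊖ lc ds vs    ≡⟨ inverseʳ (lc ds vs) ⟩
      𝟎                      ∎))
    where open ≡-Reasoning

  independent-∷ : ∀ {n m} {vs : Vec (Vect F n) m} {w} →
    Independent vs → ¬ InSpan vs w → Independent (w ∷ vs)
  independent-∷ {vs = vs} {w} vs-indep w∉ (c ∷ cs) eq with c ≟ 0#
  ... | yes refl = cong (0# ∷_) (vs-indep cs (trans (sym (linComb-0∷ w vs cs)) eq))
  ... | no c≢0 with inverse c c≢0
  ... | c⁻¹ , cc⁻¹≡1 = ⊥-elim (w∉ ((c⁻¹ *ᶠ - 1#) ⊙ cs , solve-for-w))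
    where
    open ≡-Reasoning
    solve-for-w : w ≡ lc ((c⁻¹ *ᶠ - 1#) ⊙ cs) vs
    solve-for-w = begin
      w                           ≡⟨ sym (⊙-identityˡ w) ⟩
      1# ⊙ w                      ≡⟨ cong (_⊙ w) (trans (sym cc⁻¹≡1) (*-comm c c⁻¹)) ⟩
      (c⁻¹ *ᶠ c) ⊙ w              ≡⟨ sym (⊙-assoc c⁻¹ c w) ⟩
      c⁻¹ ⊙ c ⊙ w                 ≡⟨ cong (c⁻¹ ⊙_) (inverseˡ-unique (c ⊙ w) (lc cs vs) eq) ⟩
      c⁻¹ ⊙ map -_ (lc cs vs)     ≡⟨ cong (c⁻¹ ⊙_) (-‿≡-1⊙ _) ⟩
      c⁻¹ ⊙ (- 1#) ⊙ lc cs vs     ≡⟨ ⊙-assoc c⁻¹ (- 1#) _ ⟩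
      (c⁻¹ *ᶠ - 1#) ⊙ lc cs vs    ≡⟨ sym (linComb-⊙ _ cs vs) ⟩
      lc ((c⁻¹ *ᶠ - 1#) ⊙ cs) vs  ∎

  inSpan-∷ : ∀ {n m} {vs : Vec (Vect F n) m} {v} w → InSpan vs v → InSpan (w ∷ vs) v
  inSpan-∷ {vs = vs} w (cs , v≡) = 0# ∷ cs , trans v≡ (sym (linComb-0∷ w vs cs))

  inSpan-head : ∀ {n m} (vs : Vec (Vect F n) m) w → InSpan (w ∷ vs) w
  inSpan-head vs w = 1# ∷ replicate _ 0# , sym (linComb-1∷zeros w vs)

  inSpan-linComb : ∀ {n m j} {vs : Vec (Vect F n) m} {ws : Vec (Vect F n) j} →
    All (InSpan vs) ws → ∀ cs → InSpan vs (lc cs ws)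
  inSpan-linComb {vs = vs} []                     []       = replicate _ 0# , sym (linComb-zeros vs)
  inSpan-linComb {vs = vs} ((a , w≡) ∷ ws-in) (c ∷ cs) with inSpan-linComb ws-in cs
  ... | b , rest≡ = c ⊙ a ⊕ b , (begin
    c ⊙ _ ⊕ lc cs _             ≡⟨ cong₂ (λ x y → c ⊙ x ⊕ y) w≡ rest≡ ⟩
    c ⊙ lc a vs ⊕ lc b vs       ≡⟨ cong (_⊕ lc b vs) (sym (linComb-⊙ c a vs)) ⟩
    lc (c ⊙ a) vs ⊕ lc b vs     ≡⟨ sym (linComb-⊕ (c ⊙ a) b vs) ⟩
    lc (c ⊙ a ⊕ b) vs           ∎)
    where open ≡-Reasoning

  independent⇒≤ : ∀ {n m j} {vs : Vec (Vect F n) m} {ws : Vec (Vect F n) j} →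
    Independent vs → All (InSpan ws) vs → m ≤ j
  independent⇒≤ {vs = vs} {ws} vs-indep vs-in = injective⇒≤ (proj₁ ∘ coords) λ {cs} {ds} eq →
    independent⇒linComb-injective vs-indep (begin
      lc cs vs                     ≡⟨ proj₂ (coords cs) ⟩
      lc (proj₁ (coords cs)) ws    ≡⟨ cong (λ es → lc es ws) eq ⟩
      lc (proj₁ (coords ds)) ws    ≡⟨ sym (proj₂ (coords ds)) ⟩
      lc ds vs                     ∎)
    where
    open ≡-Reasoning
    coords : ∀ cs → InSpan ws (lc cs vs)
    coords = inSpan-linComb vs-in

  independent⇒≤dim : ∀ {n m} {vs : Vec (Vect F n) m} → Independent vs → m ≤ n
  independent⇒≤dim {vs = vs} vs-indep =
    injective⇒≤ (λ cs → lc cs vs) (independent⇒linComb-injective vs-indep)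

  full-dimension⇒universal : ∀ {n d} {P : Pred F n} → IsSubspace F P → HasDim F P d →
    n ≤ d → ∀ v → P v
  full-dimension⇒universal {P = P} P-sub (B , B⊆P , B-indep , _) n≤d v with inSpan? B v
  ... | yes (cs , v≡) = subst P (sym v≡) (subspace-linComb P-sub (All.lookup⁻ B⊆P) cs)
  ... | no v∉B        = contradiction n≤d (ℕ.<⇒≱ (independent⇒≤dim (independent-∷ B-indep v∉B)))

  record BasisExtension {n d j} (W : Pred F n) (B : Vec (Vect F n) d) (ws : Vec (Vect F n) j) : Set where
    field
      {size}      : ℕ
      new         : Vec (Vect F n) size
      new⊆W       : All W new
      independent : Independent (new ++ B)
      spans       : All (InSpan (new ++ B)) ws

  extendBasis : ∀ {n d j} {W : Pred F n} {B : Vec (Vect F n) d} {ws : Vec (Vect F n) j} →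
    Independent B → All W ws → BasisExtension W B ws
  extendBasis B-indep [] = record { new = [] ; new⊆W = [] ; independent = B-indep ; spans = [] }
  extendBasis {B = B} {w ∷ _} B-indep (w∈W ∷ ws⊆W) with extendBasis B-indep ws⊆W
  ... | record { new = C ; new⊆W = C⊆W ; independent = CB-indep ; spans = ws-in }
    with inSpan? (C ++ B) w
  ...   | yes w-in = record { new = C ; new⊆W = C⊆W ; independent = CB-indep ; spans = w-in ∷ ws-in }
  ...   | no  w∉   = record
    { new         = w ∷ C
    ; new⊆W       = w∈W ∷ C⊆W
    ; independent = independent-∷ CB-indep w∉
    ; spans       = inSpan-head (C ++ B) w ∷ All.map (inSpan-∷ w) ws-in
    }

  module Coordinates {n m} {W : Pred F n} (W-sub : IsSubspace F W)
    {L : Vec (Vect F n) m} (L⊆W : All W L) (L-indep : Independent L)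
    (L-spans : ∀ v → W v → InSpan L v) where

    coord : Vect F n → Vec Carrier m
    coord v with inSpan? L v
    ... | yes (cs , _) = cs
    ... | no _         = replicate m 0#  -- junk value; coord is only used on W

    coord-spec : ∀ {v} → W v → v ≡ lc (coord v) L
    coord-spec {v} v∈W with inSpan? L v
    ... | yes (_ , v≡) = v≡
    ... | no v∉        = contradiction (L-spans v v∈W) v∉

    coord-unique : ∀ {v} cs → v ≡ lc cs L → coord v ≡ cs
    coord-unique cs v≡ = independent⇒linComb-injective L-indep
      (trans (sym (coord-spec (subst W (sym v≡) (subspace-linComb W-sub L⊆W cs)))) v≡)

    extend : Vec (Vect F n) m → Vect F n → Vect F n
    extend imgs v = lc (coord v) imgs

    extend-linComb : ∀ imgs cs → extend imgs (lc cs L) ≡ lc cs imgs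
    extend-linComb imgs cs = cong (λ ds → lc ds imgs) (coord-unique cs refl)

    extend-linear : ∀ imgs → LinearOn F W (extend imgs)
    extend-linear imgs a b u v u∈W v∈W =
      trans (cong (λ cs → lc cs imgs) coord-linear) (linComb-linear a b (coord u) (coord v) imgs)
      where
      coord-linear : coord (a ⊙ u ⊕ b ⊙ v) ≡ a ⊙ coord u ⊕ b ⊙ coord v
      coord-linear = coord-unique _ (trans
        (cong₂ (λ x y → a ⊙ x ⊕ b ⊙ y) (coord-spec u∈W) (coord-spec v∈W))
        (sym (linComb-linear a b (coord u) (coord v) L)))

    extend-injective : ∀ {imgs imgs′} → SameOn F W (extend imgs) (extend imgs′) → imgs ≡ imgs′
    extend-injective {imgs} {imgs′} same = linComb-extensional imgs imgs′ λ cs →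
      trans (sym (extend-linComb imgs cs))
            (trans (same _ (subspace-linComb W-sub L⊆W cs)) (extend-linComb imgs′ cs))

    extend-unique : ∀ {T imgs} → LinearOn F W T → map T L ≡ imgs → SameOn F W T (extend imgs)
    extend-unique {T} {imgs} T-lin TL≡imgs w w∈W = begin
      T w                     ≡⟨ cong T (coord-spec w∈W) ⟩
      T (lc (coord w) L)      ≡⟨ linear-linComb W-sub T-lin L⊆W (coord w) ⟩
      lc (coord w) (map T L)  ≡⟨ cong (lc (coord w)) TL≡imgs ⟩
      extend imgs w           ∎
      where open ≡-Reasoning

  _+ˢ_ : ∀ {n} → Pred F n → Pred F n → Pred F n
  (Z +ˢ U) v = ∃ λ z → ∃ λ u → Z z × U u × v ≡ z ⊕ u

  +ˢ-subspace : ∀ {n} {Z U : Pred F n} → IsSubspace F Z → IsSubspace F U → IsSubspace F (Z +ˢ U)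
  +ˢ-subspace (Z-𝟎 , Z-⊕ , Z-⊙) (U-𝟎 , U-⊕ , U-⊙) =
      (𝟎 , 𝟎 , Z-𝟎 , U-𝟎 , sym (identityˡ 𝟎))
    , (λ { _ _ (z , u , z∈Z , u∈U , refl) (z′ , u′ , z′∈Z , u′∈U , refl) →
             z ⊕ z′ , u ⊕ u′ , Z-⊕ _ _ z∈Z z′∈Z , U-⊕ _ _ u∈U u′∈U ,
             interchange z u z′ u′ })
    , (λ { a _ (z , u , z∈Z , u∈U , refl) →
             a ⊙ z , a ⊙ u , Z-⊙ a _ z∈Z , U-⊙ a _ u∈U , ⊙-distribˡ a z u })

  -- Simplicity also allows Z + U = V; the last hypothesis turns that case into Z ⊆ U.
  simplePart⇒maximalInvariant : ∀ {n} {U W : Pred F n} {T Ts : Vect F n → Vect F n} →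
    IsSubspace F U → IsSubspace F W → _⊆_ F U W →
    LinearOn F W T → (∀ u → U u → U (T u)) → SimplePartIs F W T U Ts → IsSimpleMod F U W Ts →
    ((∀ v → W v) → ∀ v → U v) → IsMaxInvariant F W T U
  simplePart⇒maximalInvariant {U = U} {W} {T} {Ts} U-sub W-sub U⊆W T-lin T-U T≈Ts Ts-simple U-whole =
    U-sub , U⊆W , T-U , maximal
    where
    open Modulo U-sub
    maximal : ∀ Z → IsSubspace F Z → _⊆_ F Z W → (∀ z → Z z → Z (T z)) → _⊆_ F Z U
    maximal Z Z-sub Z⊆W Z-inv z z∈Z =
      conclude (Ts-simple (Z +ˢ U) (+ˢ-subspace Z-sub U-sub , U⊆Z+U) Z+U⊆W Z+U-inv)
      where
      U⊆Z+U : _⊆_ F U (Z +ˢ U)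
      U⊆Z+U u u∈U = 𝟎 , u , proj₁ Z-sub , u∈U , sym (identityˡ u)
      Z+U⊆W : _⊆_ F (Z +ˢ U) W
      Z+U⊆W _ (z , u , z∈Z , u∈U , refl) = proj₁ (proj₂ W-sub) _ _ (Z⊆W z z∈Z) (U⊆W u u∈U)
      Z+U-inv : ∀ v → (Z +ˢ U) v → (Z +ˢ U) (Ts v)
      Z+U-inv _ v∈@(z , u , z∈Z , u∈U , refl) =
        T z , Ts (z ⊕ u) ⊖ T z , Z-inv z z∈Z , Ts≈Tz , sym (trans (comm _ _) (//-rightDividesˡ (T z) _))
        where
        Ts≈Tz : Ts (z ⊕ u) ≈ T z
        Ts≈Tz = ≈-trans (≈-sym (T≈Ts _ (Z+U⊆W _ v∈)))
          (≈-trans (≈-reflexive (linear-⊕ W-sub T-lin (Z⊆W z z∈Z) (U⊆W u u∈U)))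
                   (⊕-absorbʳ (T z) (T-U u u∈U)))
      conclude : SameSet F (Z +ˢ U) U ⊎ (∀ v → (Z +ˢ U) v) → U z
      conclude (inj₁ (Z+U⊆U , _)) = Z+U⊆U z (z , 𝟎 , z∈Z , proj₁ U-sub , sym (identityʳ z))
      conclude (inj₂ Z+U-whole)   = U-whole (λ v → Z+U⊆W v (Z+U-whole v)) z

  module Lifts {n d c : ℕ} {U W : Pred F n}
    (U-sub : IsSubspace F U) (W-sub : IsSubspace F W) (U⊆W : _⊆_ F U W)
    {B : Vec (Vect F n) d} (B⊆U : All U B) (B-indep : Independent B) (B-spans : ∀ v → U v → InSpan B v)
    {C : Vec (Vect F n) c} (C⊆W : All W C)
    (CB-indep : Independent (C ++ B)) (CB-spans : ∀ v → W v → InSpan (C ++ B) v)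
    {To Ts : Vect F n → Vect F n} (To-op : IsOperatorOn F U To) (Ts-lin : LinearModOn F U W Ts)
    where

    CB⊆W : All W (C ++ B)
    CB⊆W = All.++⁺ C⊆W (All.map (U⊆W _) B⊆U)

    open Coordinates W-sub CB⊆W CB-indep CB-spans
    open Modulo U-sub

    Corrections : Set
    Corrections = Vec (Vec Carrier d) c

    corrected : Vect F n → Vec Carrier d → Vect F n
    corrected v r = Ts v ⊕ lc r B

    images : Corrections → Vec (Vect F n) (c ℕ.+ d)
    images D = zipWith corrected C D ++ map To B

    lift : Corrections → Vect F n → Vect F n
    lift D = extend (images D)

    lift-on-U : ∀ D u → U u → lift D u ≡ To u
    lift-on-U D u u∈U with B-spans u u∈U
    ... | a , refl = begin
      lift D (lc a B)                              ≡⟨ cong (lift D) (sym (linComb-zeros-++ a C B)) ⟩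
      lift D (lc (replicate c 0# ++ a) (C ++ B))   ≡⟨ extend-linComb (images D) (replicate c 0# ++ a) ⟩
      lc (replicate c 0# ++ a) (images D)          ≡⟨ linComb-zeros-++ a (zipWith corrected C D) _ ⟩
      lc a (map To B)                              ≡⟨ sym (linear-linComb U-sub (proj₁ To-op) B⊆U a) ⟩
      To (lc a B)                                  ∎
      where open ≡-Reasoning

    images≈Ts : ∀ D → Pointwise _≈_ (images D) (map Ts (C ++ B))
    images≈Ts D = subst (Pointwise _≈_ (images D)) (sym (Vec.map-++ Ts C B))
      (Pointwise.++⁺ (corrections≈ C D) (To≈Ts B⊆U))
      where
      corrections≈ : ∀ {j} (vs : Vec (Vect F n) j) rs →
        Pointwise _≈_ (zipWith corrected vs rs) (map Ts vs)
      corrections≈ []       []       = []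
      corrections≈ (v ∷ vs) (r ∷ rs) =
        ⊕-absorbʳ (Ts v) (subspace-linComb U-sub B⊆U r) ∷ corrections≈ vs rs
      To≈Ts : ∀ {j} {us : Vec (Vect F n) j} → All U us → Pointwise _≈_ (map To us) (map Ts us)
      To≈Ts []           = []
      To≈Ts (u∈U ∷ us⊆U) = members-≈ (proj₂ To-op _ u∈U) (proj₂ Ts-lin _ u∈U) ∷ To≈Ts us⊆U

    lift-simplePart : ∀ D → SimplePartIs F W (lift D) U Ts
    lift-simplePart D w w∈W = begin
      lift D w                          ≈⟨ linComb-cong (images≈Ts D) (coord w) ⟩
      lc (coord w) (map Ts (C ++ B))    ≈⟨ ≈-sym (linearMod-linComb W-sub Ts-lin CB⊆W (coord w)) ⟩
      Ts (lc (coord w) (C ++ B))        ≡⟨ cong Ts (sym (coord-spec w∈W)) ⟩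
      Ts w                              ∎
      where open import Relation.Binary.Reasoning.Setoid ≈-setoid

    lift-injective : ∀ D D′ → SameOn F W (lift D) (lift D′) → D ≡ D′
    lift-injective D D′ same = rows C D D′ (Vec.++-injectiveˡ _ _ (extend-injective same))
      where
      rows : ∀ {j} (vs : Vec (Vect F n) j) rs rs′ →
        zipWith corrected vs rs ≡ zipWith corrected vs rs′ → rs ≡ rs′
      rows []       []       []         _  = refl
      rows (v ∷ vs) (r ∷ rs) (r′ ∷ rs′) eq = cong₂ _∷_
        (independent⇒linComb-injective B-indep (∙-cancelˡ (Ts v) _ _ (Vec.∷-injectiveˡ eq)))
        (rows vs rs rs′ (Vec.∷-injectiveʳ eq))

    lift-complete : ∀ {T} → LinearOn F W T → (∀ u → U u → T u ≡ To u) → SimplePartIs F W T U Ts →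
      ∃ λ D → SameOn F W T (lift D)
    lift-complete {T} T-lin T=To T≈Ts = D , extend-unique T-lin (begin
      map T (C ++ B)                        ≡⟨ Vec.map-++ T C B ⟩
      map T C ++ map T B                    ≡⟨ cong₂ _++_ (T-on-C C⊆W) (T-on-B B⊆U) ⟩
      zipWith corrected C D ++ map To B     ∎)
      where
      open ≡-Reasoning
      module U-coords = Coordinates U-sub B⊆U B-indep B-spans
      correction : Vect F n → Vec Carrier d
      correction v = U-coords.coord (T v ⊖ Ts v)
      D : Corrections
      D = map correction C
      T-on-C : ∀ {j} {vs : Vec (Vect F n) j} → All W vs →
        map T vs ≡ zipWith corrected vs (map correction vs)
      T-on-C []                     = refl
      T-on-C {vs = v ∷ _} (v∈W ∷ vs⊆W) = cong₂ _∷_ (begin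
        T v                         ≡⟨ sym (trans (comm _ _) (//-rightDividesˡ (Ts v) (T v))) ⟩
        Ts v ⊕ (T v ⊖ Ts v)         ≡⟨ cong (Ts v ⊕_) (U-coords.coord-spec (T≈Ts v v∈W)) ⟩
        corrected v (correction v)  ∎) (T-on-C vs⊆W)
      T-on-B : ∀ {j} {us : Vec (Vect F n) j} → All U us → map T us ≡ map To us
      T-on-B []           = refl
      T-on-B (u∈U ∷ us⊆U) = cong₂ _∷_ (T=To _ u∈U) (T-on-B us⊆U)

    Good : (Vect F n → Vect F n) → Set₁
    Good T = LinearOn F W T × OperatorPartIs F W T U To × SimplePartIs F W T U Ts

    lift-good : IsSimpleMod F U W Ts → ((∀ v → W v) → ∀ v → U v) → ∀ D → Good (lift D)
    lift-good Ts-simple U-whole D =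
      lift-linear , (maximal , lift-on-U D) , lift-simplePart D
      where
      lift-linear : LinearOn F W (lift D)
      lift-linear = extend-linear (images D)
      maximal : IsMaxInvariant F W (lift D) U
      maximal = simplePart⇒maximalInvariant U-sub W-sub U⊆W lift-linear
        (λ u u∈U → subst U (sym (lift-on-U D u u∈U)) (proj₂ To-op u u∈U))
        (lift-simplePart D) Ts-simple U-whole

    count : IsSimpleMod F U W Ts → ((∀ v → W v) → ∀ v → U v) →
      HasCount (SameOn F W) Good ((q ^ d) ^ c)
    count Ts-simple U-whole =
      HasCount-↔ {_≈_ = SameOn F W} (Fin[N^m]↔Vec (Fin[q^m]↔Vec d) c) lift
        (lift-good Ts-simple U-whole) lift-injective
        λ { T (T-lin , (_ , T=To) , T≈Ts) → lift-complete T-lin T=To T≈Ts }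

whole-domain⇒no-defects : ∀ {q n} (F : FiniteField q) {W : Pred F n} {T} λs →
  DefectDims F W T λs → (∀ v → W v) → λs ≡ List.[]
whole-domain⇒no-defects F List.[]      _                          _       = refl
whole-domain⇒no-defects F (_ List.∷ _) (_ , _ , _ , Y₀≠Y₁ , _) W-whole =
  contradiction ((λ v _ → W-whole v) , (λ _ _ → tt)) (Y₀≠Y₁ 0 (ℕ.s≤s ℕ.z≤n))

mainTheorem10 : (q : ℕ) (F : FiniteField q) (n d k : ℕ)
    (U W : Pred F n) →
    IsSubspace F U → IsSubspace F W → _⊆_ F U W →
    HasDim F U d → HasDim F W k →
    (To : Vect F n → Vect F n) → IsOperatorOn F U To →
    (Ts : Vect F n → Vect F n) → LinearModOn F U W Ts →
    IsSimpleMod F U W Ts →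
    (λs : List ℕ) → DefectDims F W Ts λs → IsPartition λs (n ∸ d) →
    HasCount (SameOn F W)
      (λ T → LinearOn F W T × OperatorPartIs F W T U To × SimplePartIs F W T U Ts)
      (q ^ (d * (k ∸ d)))
mainTheorem10 q F n d k U W U-sub W-sub U⊆W U-dim@(B , B⊆U , B-indep , B-spans)
  (E , E⊆W , E-indep , E-spans) To To-op Ts Ts-lin Ts-simple λs defects (_ , _ , Σλs≡n∸d) =
  subst (HasCount (SameOn F W) Good) exponent (count Ts-simple U-whole)
  where
  open BasisExtension (extendBasis F {W = W} {ws = E} B-indep (All.lookup⁻ E⊆W))
    renaming (new to C; size to c)
  CB-spans : ∀ v → W v → InSpan F (C ++ B) v
  CB-spans v v∈W with E-spans v v∈W
  ... | cs , refl = inSpan-linComb F spans cs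
  open Lifts F U-sub W-sub U⊆W (All.lookup⁻ B⊆U) B-indep B-spans
    new⊆W independent CB-spans To-op Ts-lin
  c≡k∸d : c ≡ k ∸ d
  c≡k∸d = sym (trans (cong (_∸ d) (ℕ.≤-antisym k≤c+d c+d≤k)) (ℕ.m+n∸n≡m c d))
    where
    k≤c+d : k ≤ c ℕ.+ d
    k≤c+d = independent⇒≤ F E-indep spans
    c+d≤k : c ℕ.+ d ≤ k
    c+d≤k = independent⇒≤ F independent (All.map (E-spans _) CB⊆W)
  U-whole : (∀ v → W v) → ∀ v → U v
  U-whole W-whole with whole-domain⇒no-defects F λs defects W-whole
  ... | refl = full-dimension⇒universal F U-sub U-dim (ℕ.m∸n≡0⇒m≤n (sym Σλs≡n∸d))
  exponent : (q ^ d) ^ c ≡ q ^ (d * (k ∸ d))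
  exponent = trans (ℕ.^-*-assoc q d c) (cong (λ e → q ^ (d * e)) c≡k∸d)
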